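{- Let $n\ge 2$ be an integer and let $\tilde{R}_n\subset\mathbb{R}^n$ be the convex hull of the vectors $c_1,\ldots,c_{n-1}$, where $c_1=(1,0,\ldots,0)$ and, for $2\le j\le n-1$, $c_j$ is the vector whose coordinates $1,\ldots,j-1$ equal $1$, whose $j$th coordinate equals $n-j+1$, and whose remaining coordinates equal $0$. Then $\tilde{R}_n$ is translation equivalent (by a lattice translation) to a reflexive polytope, with respect to the lattice of integer points in its affine span.
   Context: Equivalently, $\tilde R_n$ is the convex hull of the first $n-1$ columns of the $n\times n$ upper triangular matrix whose first row is all $1$'s, whose diagonal is $(1,n-1,n-2,\ldots,1)$, and whose entries above the diagonal are all $1$; the full set of $n$ columns spans the simplex $R_n$, which is a height-1 lattice pyramid over $\tilde R_n$ with apex $(1,1,\ldots,1)$. A lattice polytope is reflexive if its polar dual (taken relative to its affine lattice with an interior lattice point as origin) is also a lattice polytope.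
   Formalization: The ambient space is ℚ^n rather than ℝ^n, so the polar dual of $\tilde R_n$ consists of rational functionals and the convex combinations describing it have rational coefficients. -}

module Defs where

open import Data.Nat as ℕ using (ℕ; _∸_)
open import Data.Integer as ℤ using (ℤ; +_)
open import Data.Rational using (ℚ; 0ℚ; 1ℚ; _+_; _*_; _-_; -_; _≤_; _<_; _/_)
open import Data.Fin using (Fin; toℕ; zero; suc)
open import Data.Nat using (_<ᵇ_; _≡ᵇ_)
open import Data.Bool using (if_then_else_)
open import Data.Product using (Σ; ∃; ∃-syntax; _×_)
open import Relation.Binary.PropositionalEquality using (_≡_)
open import Function.Bundles using (_⇔_)

Pt : ℕ → Set
Pt n = Fin n → ℚ

ℤ→ℚ : ℤ → ℚ
ℤ→ℚ z = z / 1

ℕ→ℚ : ℕ → ℚ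
ℕ→ℚ k = (+ k) / 1

Σℚ : ∀ {k} → (Fin k → ℚ) → ℚ
Σℚ {ℕ.zero}  f = 0ℚ
Σℚ {ℕ.suc k} f = f zero + Σℚ (λ i → f (suc i))

dot : ∀ {n} → Pt n → Pt n → ℚ
dot x y = Σℚ (λ i → x i * y i)

IsComb : ∀ {n k} → (Fin k → Pt n) → (Fin k → ℚ) → Pt n → Set
IsComb v μ x = ∀ i → x i ≡ Σℚ (λ j → μ j * v j i)

IsLatticePt : ∀ {n} → Pt n → Set
IsLatticePt x = ∀ i → ∃[ z ] x i ≡ ℤ→ℚ z

IsIntℚ : ℚ → Set
IsIntℚ q = ∃[ z ] q ≡ ℤ→ℚ z

InRelInt : ∀ {n k} → (Fin k → Pt n) → Pt n → Set
InRelInt v x = ∃[ λ' ] ((∀ j → 0ℚ < λ' j) × (Σℚ λ' ≡ 1ℚ) × IsComb v λ' x)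

-- ℓ lies in the (linear) direction space of the affine span of v_1..v_k,
-- i.e. ℓ = Σ μ_j v_j with Σ μ_j = 0
InAffDir : ∀ {n k} → (Fin k → Pt n) → Pt n → Set
InAffDir v ℓ = ∃[ μ ] ((Σℚ μ ≡ 0ℚ) × IsComb v μ ℓ)

-- Functionals on the direction space V of aff(P) are represented by
-- vectors y ∈ ℚ^n (every functional on V extends to ℚ^n); two vectors
-- represent the same functional iff they agree on the spanning vectors
-- v_j - m of V.
val : ∀ {n k} → (Fin k → Pt n) → Pt n → Pt n → Fin k → ℚ
val v m y j = dot y (λ i → v j i - m i)

-- y is a point of the dual lattice Hom(L, ℤ), L = V ∩ ℤ^n
InDualLattice : ∀ {n k} → (Fin k → Pt n) → Pt n → Set
InDualLattice v y = ∀ ℓ → IsLatticePt ℓ → InAffDir v ℓ → IsIntℚ (dot y ℓ)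

-- y lies in the polar dual of P - m (P = conv v):  ⟨y, x - m⟩ ≥ -1 on P
-- (equivalently on its vertices v_j)
InPolar : ∀ {n k} → (Fin k → Pt n) → Pt n → Pt n → Set
InPolar v m y = ∀ j → - 1ℚ ≤ val v m y j

InConvDual : ∀ {n k r} → (Fin k → Pt n) → Pt n → (Fin r → Pt n) → Pt n → Set
InConvDual v m Y y =
  ∃[ λ' ] ((∀ s → 0ℚ ≤ λ' s) × (Σℚ λ' ≡ 1ℚ)
          × (∀ j → val v m y j ≡ Σℚ (λ s → λ' s * val v m (Y s) j)))

-- The polar dual of P - m (w.r.t. the lattice aff(P) ∩ ℤ^n, translated by m)
-- is a lattice polytope: it equals the convex hull of finitely many dual
-- lattice points.
PolarIsLatticePolytope : ∀ {n k} → (Fin k → Pt n) → Pt n → Set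
PolarIsLatticePolytope {n} v m =
  ∃[ r ] ∃[ Y ] ((∀ (s : Fin r) → InDualLattice v (Y s))
               × (∀ (y : Pt n) → InPolar v m y ⇔ InConvDual v m Y y))

-- P = conv(v) translated by the lattice point m (which is interior in P)
-- is reflexive with respect to the lattice aff(P) ∩ ℤ^n (moved by -m).
ReflexiveAfterTranslation : ∀ {n k} → (Fin k → Pt n) → Pt n → Set
ReflexiveAfterTranslation v m =
  IsLatticePt m × InRelInt v m × PolarIsLatticePolytope v m

-- The vectors c_1, ..., c_{n-1} in ℚ^n (0-based indices j, i here):
-- c_1 = (1,0,...,0); for 2 ≤ J ≤ n-1 (J = j+1), coordinates I < J are 1,
-- coordinate J is n-J+1, the rest 0 (I = i+1).
c : (n : ℕ) → Fin (n ∸ 1) → Pt n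
c n j i with toℕ j
... | ℕ.zero  = if toℕ i ≡ᵇ 0 then 1ℚ else 0ℚ
... | ℕ.suc j' =
  let J = ℕ.suc (ℕ.suc j') ; I = ℕ.suc (toℕ i) in
  if I <ᵇ J then 1ℚ else (if I ≡ᵇ J then ℕ→ℚ (n ∸ J ℕ.+ 1) else 0ℚ)

-- With m = (1,…,1,0) and w_j = c_j − m, the Gram matrix ⟨w_s, w_j⟩ is −1 off the
-- diagonal.  For a simplex with m in its interior this forces the polar dual of P − m to
-- be the simplex spanned by the functionals ⟨w_s, ·⟩: writing m = Σ β_j c_j, every
-- functional y satisfies Σ β_j y(w_j) = 0, so the weights β_s (y(w_s) + 1) form a convex
-- combination reproducing y exactly when y ≥ −1 on P − m.  The w_s are integer vectors,
-- hence the polar dual is a lattice polytope.  The Gram matrix and the β_j are computed by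
-- induction on n: deleting the second coordinate turns the w_j in dimension n + 1 into
-- those in dimension n, with the first two merged.

module Submission where

open import Defs
open import Data.Nat as ℕ using (ℕ; zero; suc; _≤_; z≤n; s≤s; _<ᵇ_; _≡ᵇ_)
import Data.Nat.Properties as ℕ
import Data.Integer as ℤ
import Data.Integer.Properties as ℤ
open import Data.Rational
  using (ℚ; 0ℚ; 1ℚ; _+_; _*_; _-_; -_; _<_; _/_; toℚᵘ; Positive; positive; nonNegative)
  renaming (_≤_ to _≤ℚ_)
open import Data.Rational.Properties
import Data.Rational.Unnormalised as ℚᵘ
import Data.Rational.Unnormalised.Properties as ℚᵘ
open import Data.Rational.Solver using (module +-*-Solver)
open +-*-Solver using (solve; _:=_; _:+_; _:*_; _:-_; :-_; con)
open import Data.Fin using (Fin; zero; suc; toℕ)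
open import Data.Fin.Properties using (suc-injective)
open import Data.Bool using (true; false; if_then_else_)
open import Data.Product using (∃-syntax; _,_)
open import Data.Empty using (⊥-elim)
open import Function using (_∘_)
open import Function.Bundles using (_⇔_; mk⇔)
open import Relation.Binary.PropositionalEquality

toℚᵘ-ℤ→ℚ : ∀ z → toℚᵘ (ℤ→ℚ z) ℚᵘ.≃ ℚᵘ.mkℚᵘ z 0
toℚᵘ-ℤ→ℚ z = toℚᵘ-fromℚᵘ (ℚᵘ.mkℚᵘ z 0)

ℤ→ℚ-+ : ∀ a b → ℤ→ℚ (a ℤ.+ b) ≡ ℤ→ℚ a + ℤ→ℚ b
ℤ→ℚ-+ a b = toℚᵘ-injective (begin
  toℚᵘ (ℤ→ℚ (a ℤ.+ b))            ≈⟨ toℚᵘ-ℤ→ℚ (a ℤ.+ b) ⟩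
  ℚᵘ.mkℚᵘ (a ℤ.+ b) 0              ≈⟨ ℚᵘ.*≡* (cong₂ (λ x y → (x ℤ.+ y) ℤ.* ℤ.+ 1)
                                        (sym (ℤ.*-identityʳ a)) (sym (ℤ.*-identityʳ b))) ⟩
  ℚᵘ.mkℚᵘ a 0 ℚᵘ.+ ℚᵘ.mkℚᵘ b 0     ≈⟨ ℚᵘ.+-cong (toℚᵘ-ℤ→ℚ a) (toℚᵘ-ℤ→ℚ b) ⟨
  toℚᵘ (ℤ→ℚ a) ℚᵘ.+ toℚᵘ (ℤ→ℚ b)   ≈⟨ toℚᵘ-homo-+ (ℤ→ℚ a) (ℤ→ℚ b) ⟨
  toℚᵘ (ℤ→ℚ a + ℤ→ℚ b)             ∎)
  where open ℚᵘ.≃-Reasoning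

ℤ→ℚ-* : ∀ a b → ℤ→ℚ (a ℤ.* b) ≡ ℤ→ℚ a * ℤ→ℚ b
ℤ→ℚ-* a b = toℚᵘ-injective (begin
  toℚᵘ (ℤ→ℚ (a ℤ.* b))            ≈⟨ toℚᵘ-ℤ→ℚ (a ℤ.* b) ⟩
  ℚᵘ.mkℚᵘ a 0 ℚᵘ.* ℚᵘ.mkℚᵘ b 0     ≈⟨ ℚᵘ.*-cong (toℚᵘ-ℤ→ℚ a) (toℚᵘ-ℤ→ℚ b) ⟨
  toℚᵘ (ℤ→ℚ a) ℚᵘ.* toℚᵘ (ℤ→ℚ b)   ≈⟨ toℚᵘ-homo-* (ℤ→ℚ a) (ℤ→ℚ b) ⟨
  toℚᵘ (ℤ→ℚ a * ℤ→ℚ b)             ∎)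
  where open ℚᵘ.≃-Reasoning

ℤ→ℚ-neg : ∀ a → ℤ→ℚ (ℤ.- a) ≡ - ℤ→ℚ a
ℤ→ℚ-neg a = toℚᵘ-injective (begin
  toℚᵘ (ℤ→ℚ (ℤ.- a))   ≈⟨ toℚᵘ-ℤ→ℚ (ℤ.- a) ⟩
  ℚᵘ.- ℚᵘ.mkℚᵘ a 0      ≈⟨ ℚᵘ.-‿cong (toℚᵘ-ℤ→ℚ a) ⟨
  ℚᵘ.- toℚᵘ (ℤ→ℚ a)     ≈⟨ toℚᵘ-homo‿- (ℤ→ℚ a) ⟨
  toℚᵘ (- ℤ→ℚ a)        ∎)
  where open ℚᵘ.≃-Reasoning

ℕ→ℚ-suc : ∀ k → ℕ→ℚ (suc k) ≡ ℕ→ℚ k + 1ℚ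
ℕ→ℚ-suc k = trans (cong ℕ→ℚ (ℕ.+-comm 1 k)) (ℤ→ℚ-+ (ℤ.+ k) (ℤ.+ 1))

recip : ℕ → ℚ
recip k = ℤ.+ 1 / suc k

recip-positive : ∀ k → Positive (recip k)
recip-positive k = normalize-pos 1 (suc k)

recip-inverse : ∀ k → recip k * ℕ→ℚ (suc k) ≡ 1ℚ
recip-inverse k = toℚᵘ-injective (begin
  toℚᵘ (recip k * ℕ→ℚ (suc k))                 ≈⟨ toℚᵘ-homo-* (recip k) (ℕ→ℚ (suc k)) ⟩
  toℚᵘ (recip k) ℚᵘ.* toℚᵘ (ℕ→ℚ (suc k))       ≈⟨ ℚᵘ.*-cong (toℚᵘ-fromℚᵘ (ℚᵘ.mkℚᵘ (ℤ.+ 1) k))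
                                                              (toℚᵘ-ℤ→ℚ (ℤ.+ suc k)) ⟩
  ℚᵘ.mkℚᵘ (ℤ.+ 1) k ℚᵘ.* ℚᵘ.mkℚᵘ (ℤ.+ suc k) 0  ≈⟨ ℚᵘ.*≡* (cong (λ x → ℤ.+ suc x) (ℕ.*-distribʳ-+ 1 k 0)) ⟩
  toℚᵘ 1ℚ                                      ∎)
  where open ℚᵘ.≃-Reasoning

IsIntℚ-+ : ∀ {a b} → IsIntℚ a → IsIntℚ b → IsIntℚ (a + b)
IsIntℚ-+ (x , refl) (y , refl) = x ℤ.+ y , sym (ℤ→ℚ-+ x y)

IsIntℚ-* : ∀ {a b} → IsIntℚ a → IsIntℚ b → IsIntℚ (a * b)
IsIntℚ-* (x , refl) (y , refl) = x ℤ.* y , sym (ℤ→ℚ-* x y)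

ℕ→ℚ-isInt : ∀ k → IsIntℚ (ℕ→ℚ k)
ℕ→ℚ-isInt k = ℤ.+ k , refl

IsIntℚ-neg : ∀ {a} → IsIntℚ a → IsIntℚ (- a)
IsIntℚ-neg (x , refl) = ℤ.- x , sym (ℤ→ℚ-neg x)

IsIntℚ-if : ∀ b {x y} → IsIntℚ x → IsIntℚ y → IsIntℚ (if b then x else y)
IsIntℚ-if true  x _ = x
IsIntℚ-if false _ y = y

IsIntℚ-Σℚ : ∀ {k} {f : Fin k → ℚ} → (∀ i → IsIntℚ (f i)) → IsIntℚ (Σℚ f)
IsIntℚ-Σℚ {zero}  _ = ℤ.+ 0 , refl
IsIntℚ-Σℚ {suc k} f = IsIntℚ-+ (f zero) (IsIntℚ-Σℚ (f ∘ suc))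

dot-IsIntℚ : ∀ {n} {x y : Pt n} → IsLatticePt x → IsLatticePt y → IsIntℚ (dot x y)
dot-IsIntℚ x y = IsIntℚ-Σℚ (λ i → IsIntℚ-* (x i) (y i))

Σℚ-cong : ∀ {k} {f g : Fin k → ℚ} → (∀ i → f i ≡ g i) → Σℚ f ≡ Σℚ g
Σℚ-cong {zero}  _   = refl
Σℚ-cong {suc k} f≡g = cong₂ _+_ (f≡g zero) (Σℚ-cong (f≡g ∘ suc))

Σℚ-zero : ∀ {k} {f : Fin k → ℚ} → (∀ i → f i ≡ 0ℚ) → Σℚ f ≡ 0ℚ
Σℚ-zero {zero}  _    = refl
Σℚ-zero {suc k} f≡0 = trans (cong₂ _+_ (f≡0 zero) (Σℚ-zero (f≡0 ∘ suc))) (+-identityˡ 0ℚ)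

Σℚ-+ : ∀ {k} (f g : Fin k → ℚ) → Σℚ (λ i → f i + g i) ≡ Σℚ f + Σℚ g
Σℚ-+ {zero}  _ _ = refl
Σℚ-+ {suc k} f g = trans (cong (f zero + g zero +_) (Σℚ-+ (f ∘ suc) (g ∘ suc)))
  (solve 4 (λ a b c d → (a :+ b) :+ (c :+ d) := (a :+ c) :+ (b :+ d)) refl
    (f zero) (g zero) (Σℚ (f ∘ suc)) (Σℚ (g ∘ suc)))

Σℚ-*ˡ : ∀ {k} a (f : Fin k → ℚ) → Σℚ (λ i → a * f i) ≡ a * Σℚ f
Σℚ-*ˡ {zero}  a _ = sym (*-zeroʳ a)
Σℚ-*ˡ {suc k} a f = trans (cong (a * f zero +_) (Σℚ-*ˡ a (f ∘ suc))) (sym (*-distribˡ-+ a (f zero) _))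

Σℚ-neg : ∀ {k} (f : Fin k → ℚ) → Σℚ (λ i → - f i) ≡ - Σℚ f
Σℚ-neg {zero}  _ = refl
Σℚ-neg {suc k} f = trans (cong (- f zero +_) (Σℚ-neg (f ∘ suc))) (sym (neg-distrib-+ (f zero) _))

Σℚ-swap : ∀ {k l} (f : Fin k → Fin l → ℚ) →
          Σℚ (λ i → Σℚ (λ j → f i j)) ≡ Σℚ (λ j → Σℚ (λ i → f i j))
Σℚ-swap {zero} {l} _ = sym (Σℚ-zero {l} (λ _ → refl))
Σℚ-swap {suc k} f = trans (cong (Σℚ (f zero) +_) (Σℚ-swap (f ∘ suc)))
  (sym (Σℚ-+ (f zero) (λ j → Σℚ (λ i → f (suc i) j))))

Σℚ-single : ∀ {k} (f : Fin k → ℚ) j → (∀ i → i ≢ j → f i ≡ 0ℚ) → Σℚ f ≡ f j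
Σℚ-single f zero    f≡0 = trans (cong (f zero +_) (Σℚ-zero (λ i → f≡0 (suc i) λ ())))
                                (+-identityʳ (f zero))
Σℚ-single f (suc j) f≡0 = trans (cong (_+ Σℚ (f ∘ suc)) (f≡0 zero λ ()))
  (trans (+-identityˡ _) (Σℚ-single (f ∘ suc) j (λ i i≢j → f≡0 (suc i) (i≢j ∘ suc-injective))))

Σℚ-*-−1-except : ∀ {k} (μ g : Fin k → ℚ) j → (∀ i → i ≢ j → g i ≡ - 1ℚ) →
                 Σℚ (λ i → μ i * g i) ≡ - Σℚ μ + μ j * (g j + 1ℚ)
Σℚ-*-−1-except μ g j g≡-1 = begin
  Σℚ (λ i → μ i * g i)                             ≡⟨ Σℚ-cong (λ i → solve 2 (λ x y → x :* y := :- x :+ x :* (y :+ con 1ℚ)) refl (μ i) (g i)) ⟩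
  Σℚ (λ i → - μ i + μ i * (g i + 1ℚ))              ≡⟨ Σℚ-+ (λ i → - μ i) (λ i → μ i * (g i + 1ℚ)) ⟩
  Σℚ (λ i → - μ i) + Σℚ (λ i → μ i * (g i + 1ℚ))   ≡⟨ cong₂ _+_ (Σℚ-neg μ) (Σℚ-single (λ i → μ i * (g i + 1ℚ)) j vanish) ⟩
  - Σℚ μ + μ j * (g j + 1ℚ)                        ∎
  where
  open ≡-Reasoning
  vanish : ∀ i → i ≢ j → μ i * (g i + 1ℚ) ≡ 0ℚ
  vanish i i≢j = trans (cong (λ x → μ i * (x + 1ℚ)) (g≡-1 i i≢j)) (trans (cong (μ i *_) (+-inverseˡ 1ℚ)) (*-zeroʳ (μ i)))

*-nonNeg : ∀ {a b} → 0ℚ ≤ℚ a → 0ℚ ≤ℚ b → 0ℚ ≤ℚ a * b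
*-nonNeg {a} {b} 0≤a 0≤b =
  nonNegative⁻¹ (a * b) {{nonNeg*nonNeg⇒nonNeg a {{nonNegative 0≤a}} b {{nonNegative 0≤b}}}}

balanced⇒isComb : ∀ {n k} (v : Fin k → Pt n) (m : Pt n) (β : Fin k → ℚ) → Σℚ β ≡ 1ℚ →
                     (∀ i → Σℚ (λ j → β j * (v j i - m i)) ≡ 0ℚ) → IsComb v β m
balanced⇒isComb v m β β-sum balanced i = begin
  m i                                               ≡⟨ solve 1 (λ x → con 0ℚ :+ x :* con 1ℚ := x) refl (m i) ⟨
  0ℚ + m i * 1ℚ                                     ≡⟨ cong₂ (λ a b → a + m i * b) (balanced i) β-sum ⟨
  Σℚ (λ j → β j * (v j i - m i)) + m i * Σℚ β       ≡⟨ cong (Σℚ (λ j → β j * (v j i - m i)) +_) (Σℚ-*ˡ (m i) β) ⟨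
  Σℚ (λ j → β j * (v j i - m i)) + Σℚ (λ j → m i * β j)
                                                    ≡⟨ Σℚ-+ (λ j → β j * (v j i - m i)) (λ j → m i * β j) ⟨
  Σℚ (λ j → β j * (v j i - m i) + m i * β j)        ≡⟨ Σℚ-cong (λ j → solve 3 (λ b x y → b :* (x :- y) :+ y :* b := b :* x) refl (β j) (v j i) (m i)) ⟩
  Σℚ (λ j → β j * v j i)                            ∎
  where open ≡-Reasoning

-- Y s is the facet functional of the facet opposite v s, normalised to −1 on it.
module PolarOfSimplex
  {n k} (v : Fin k → Pt n) (m : Pt n) (β : Fin k → ℚ) (Y : Fin k → Pt n)
  (β-pos : ∀ j → 0ℚ < β j) (β-sum : Σℚ β ≡ 1ℚ)
  (balanced : ∀ i → Σℚ (λ j → β j * (v j i - m i)) ≡ 0ℚ)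
  (Y-off : ∀ s j → s ≢ j → val v m (Y s) j ≡ - 1ℚ)
  where

  weighted-val≡0 : ∀ y → Σℚ (λ s → β s * val v m y s) ≡ 0ℚ
  weighted-val≡0 y = begin
    Σℚ (λ s → β s * Σℚ (λ i → y i * (v s i - m i)))   ≡⟨ Σℚ-cong (λ s → Σℚ-*ˡ (β s) (λ i → y i * (v s i - m i))) ⟨
    Σℚ (λ s → Σℚ (λ i → β s * (y i * (v s i - m i)))) ≡⟨ Σℚ-swap (λ s i → β s * (y i * (v s i - m i))) ⟩
    Σℚ (λ i → Σℚ (λ s → β s * (y i * (v s i - m i)))) ≡⟨ Σℚ-cong (λ i → Σℚ-cong λ s →
                                                           solve 3 (λ b a x → b :* (a :* x) := a :* (b :* x)) refl (β s) (y i) _) ⟩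
    Σℚ (λ i → Σℚ (λ s → y i * (β s * (v s i - m i)))) ≡⟨ Σℚ-cong (λ i → Σℚ-*ˡ (y i) (λ s → β s * (v s i - m i))) ⟩
    Σℚ (λ i → y i * Σℚ (λ s → β s * (v s i - m i)))   ≡⟨ Σℚ-zero (λ i → trans (cong (y i *_) (balanced i)) (*-zeroʳ (y i))) ⟩
    0ℚ                                                ∎
    where open ≡-Reasoning

  val-convComb : ∀ (μ : Fin k → ℚ) j →
    Σℚ (λ s → μ s * val v m (Y s) j) ≡ - Σℚ μ + μ j * (val v m (Y j) j + 1ℚ)
  val-convComb μ j = Σℚ-*-−1-except μ (λ s → val v m (Y s) j) j (λ s → Y-off s j)

  Y-diag : ∀ s → β s * (val v m (Y s) s + 1ℚ) ≡ 1ℚ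
  Y-diag s = begin
    x                          ≡⟨ solve 1 (λ x → x := (:- con 1ℚ :+ x) :+ con 1ℚ) refl x ⟩
    (- 1ℚ + x) + 1ℚ            ≡⟨ cong (λ σ → (- σ + x) + 1ℚ) β-sum ⟨
    (- Σℚ β + x) + 1ℚ          ≡⟨ cong (_+ 1ℚ) (Σℚ-*-−1-except β (val v m (Y s)) s (λ j j≢s → Y-off s j (≢-sym j≢s))) ⟨
    Σℚ (λ j → β j * val v m (Y s) j) + 1ℚ ≡⟨ cong (_+ 1ℚ) (weighted-val≡0 (Y s)) ⟩
    0ℚ + 1ℚ                    ≡⟨ +-identityˡ 1ℚ ⟩
    1ℚ                         ∎
    where
    open ≡-Reasoning
    x = β s * (val v m (Y s) s + 1ℚ)

  diag+1-nonNeg : ∀ j → 0ℚ ≤ℚ val v m (Y j) j + 1ℚ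
  diag+1-nonNeg j = ≮⇒≥ λ neg → <-asym (positive⁻¹ 1ℚ) (begin-strict
    1ℚ                                 ≡⟨ Y-diag j ⟨
    β j * (val v m (Y j) j + 1ℚ)       <⟨ *-monoʳ-<-pos (β j) {{positive (β-pos j)}} neg ⟩
    β j * 0ℚ                           ≡⟨ *-zeroʳ (β j) ⟩
    0ℚ                                 ∎)
    where open ≤-Reasoning

  polar⇒convDual : ∀ y → InPolar v m y → InConvDual v m Y y
  polar⇒convDual y polar = μ , μ-nonNeg , μ-sum , λ j → sym (val-μ j)
    where
    open ≡-Reasoning
    a : Fin k → ℚ
    a = val v m y
    μ : Fin k → ℚ
    μ s = β s * (a s + 1ℚ)
    μ-nonNeg : ∀ s → 0ℚ ≤ℚ μ s
    μ-nonNeg s = *-nonNeg (<⇒≤ (β-pos s)) (≤-trans (≤-reflexive (sym (+-inverseˡ 1ℚ))) (+-monoˡ-≤ 1ℚ (polar s)))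
    μ-sum : Σℚ μ ≡ 1ℚ
    μ-sum = begin
      Σℚ μ                                           ≡⟨ Σℚ-cong (λ s → *-distribˡ-+ (β s) (a s) 1ℚ) ⟩
      Σℚ (λ s → β s * a s + β s * 1ℚ)                ≡⟨ Σℚ-+ (λ s → β s * a s) (λ s → β s * 1ℚ) ⟩
      Σℚ (λ s → β s * a s) + Σℚ (λ s → β s * 1ℚ)     ≡⟨ cong₂ _+_ (weighted-val≡0 y) (Σℚ-cong (λ s → *-identityʳ (β s))) ⟩
      0ℚ + Σℚ β                                      ≡⟨ trans (+-identityˡ (Σℚ β)) β-sum ⟩
      1ℚ                                             ∎
    val-μ : ∀ j → Σℚ (λ s → μ s * val v m (Y s) j) ≡ a j
    val-μ j = begin
      Σℚ (λ s → μ s * val v m (Y s) j)             ≡⟨ val-convComb μ j ⟩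
      - Σℚ μ + μ j * (val v m (Y j) j + 1ℚ)        ≡⟨ cong (λ x → - x + μ j * (val v m (Y j) j + 1ℚ)) μ-sum ⟩
      - 1ℚ + μ j * (val v m (Y j) j + 1ℚ)          ≡⟨ solve 3 (λ b x g → :- con 1ℚ :+ (b :* (x :+ con 1ℚ)) :* (g :+ con 1ℚ)
                                                                := :- con 1ℚ :+ (x :+ con 1ℚ) :* (b :* (g :+ con 1ℚ)))
                                                         refl (β j) (a j) (val v m (Y j) j) ⟩
      - 1ℚ + (a j + 1ℚ) * (β j * (val v m (Y j) j + 1ℚ)) ≡⟨ cong (λ x → - 1ℚ + (a j + 1ℚ) * x) (Y-diag j) ⟩
      - 1ℚ + (a j + 1ℚ) * 1ℚ                       ≡⟨ solve 1 (λ x → :- con 1ℚ :+ (x :+ con 1ℚ) :* con 1ℚ := x) refl (a j) ⟩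
      a j                                          ∎

  convDual⇒polar : ∀ y → InConvDual v m Y y → InPolar v m y
  convDual⇒polar y (μ , μ-nonNeg , μ-sum , val-y) j = begin
    - 1ℚ                                    ≡⟨ +-identityʳ (- 1ℚ) ⟨
    - 1ℚ + 0ℚ                               ≤⟨ +-monoʳ-≤ (- 1ℚ) (*-nonNeg (μ-nonNeg j) (diag+1-nonNeg j)) ⟩
    - 1ℚ + μ j * (val v m (Y j) j + 1ℚ)     ≡⟨ cong (λ x → - x + μ j * (val v m (Y j) j + 1ℚ)) μ-sum ⟨
    - Σℚ μ + μ j * (val v m (Y j) j + 1ℚ)   ≡⟨ val-convComb μ j ⟨
    Σℚ (λ s → μ s * val v m (Y s) j)        ≡⟨ val-y j ⟨
    val v m y j                             ∎
    where open ≤-Reasoning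

  polar⇔convDual : ∀ y → InPolar v m y ⇔ InConvDual v m Y y
  polar⇔convDual y = mk⇔ (polar⇒convDual y) (convDual⇒polar y)

onesThenZero : (k : ℕ) → Pt (suc k)
onesThenZero zero    zero    = 0ℚ
onesThenZero (suc k) zero    = 1ℚ
onesThenZero (suc k) (suc i) = onesThenZero k i

onesThenZero-isLattice : ∀ k → IsLatticePt (onesThenZero k)
onesThenZero-isLattice zero    zero    = ℤ.+ 0 , refl
onesThenZero-isLattice (suc k) zero    = ℤ.+ 1 , refl
onesThenZero-isLattice (suc k) (suc i) = onesThenZero-isLattice k i

-- Indices are 0-based and n = p + 2: w p j is the paper's c_{j+1} − m.
w : (p : ℕ) → Fin (suc p) → Pt (suc (suc p))
w p j i = c (suc (suc p)) j i - onesThenZero (suc p) i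

gram : (p : ℕ) → Fin (suc p) → Fin (suc p) → ℚ
gram p s j = Σℚ (λ k → w p s (suc k) * w p j (suc k))

w-zero : ∀ p j → w p j zero ≡ 0ℚ
w-zero p zero    = refl
w-zero p (suc j) = refl

val-w : ∀ p s j → val (c (suc (suc p))) (onesThenZero (suc p)) (w p s) j ≡ gram p s j
val-w p s j = trans (cong₂ (λ x y → x * y + gram p s j) (w-zero p s) (w-zero p j)) (+-identityˡ (gram p s j))

-- Coordinate 1 of w (p + 1) j is top p j; the remaining coordinates form w p (collapse j).
collapse : ∀ {p} → Fin (suc (suc p)) → Fin (suc p)
collapse zero          = zero
collapse (suc zero)    = zero
collapse (suc (suc j)) = suc j

top : (p : ℕ) → Fin (suc (suc p)) → ℚ
top p zero          = - 1ℚ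
top p (suc zero)    = ℕ→ℚ (suc p)
top p (suc (suc _)) = 0ℚ

w-top : ∀ p j → w (suc p) j (suc zero) ≡ top p j
w-top p zero          = refl
w-top p (suc zero)    = trans (cong (_- 1ℚ) (ℤ→ℚ-+ (ℤ.+ suc p) (ℤ.+ 1)))
                              (solve 1 (λ x → x :+ con 1ℚ :- con 1ℚ := x) refl (ℕ→ℚ (suc p)))
w-top p (suc (suc j)) = refl

w-step : ∀ p j k → w (suc p) j (suc (suc k)) ≡ w p (collapse j) (suc k)
w-step p zero          k = refl
w-step p (suc zero)    k = refl
w-step p (suc (suc j)) k = refl

gram-step : ∀ p s j → gram (suc p) s j ≡ top p s * top p j + gram p (collapse s) (collapse j)
gram-step p s j = cong₂ _+_ (cong₂ _*_ (w-top p s) (w-top p j))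
                            (Σℚ-cong (λ k → cong₂ _*_ (w-step p s k) (w-step p j k)))

gram-zero-zero : ∀ p → gram p zero zero ≡ ℕ→ℚ p
gram-zero-zero zero    = refl
gram-zero-zero (suc p) = begin
  gram (suc p) zero zero           ≡⟨ gram-step p zero zero ⟩
  - 1ℚ * - 1ℚ + gram p zero zero   ≡⟨ cong (- 1ℚ * - 1ℚ +_) (gram-zero-zero p) ⟩
  - 1ℚ * - 1ℚ + ℕ→ℚ p              ≡⟨ solve 1 (λ x → :- con 1ℚ :* :- con 1ℚ :+ x := x :+ con 1ℚ) refl (ℕ→ℚ p) ⟩
  ℕ→ℚ p + 1ℚ                       ≡⟨ ℕ→ℚ-suc p ⟨
  ℕ→ℚ (suc p)                      ∎
  where open ≡-Reasoning

collapse-≢ : ∀ {p} (s : Fin (suc (suc p))) j → s ≢ suc (suc j) → collapse s ≢ suc j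
collapse-≢ (suc (suc s)) j s≢j refl = s≢j refl

gram-off : ∀ p s j → s ≢ j → gram p s j ≡ - 1ℚ
gram-off zero    zero zero s≢j = ⊥-elim (s≢j refl)
gram-off (suc p) s    j    s≢j = trans (gram-step p s j) (gram-step-off s j s≢j)
  where
  first-two : - 1ℚ * ℕ→ℚ (suc p) + gram p zero zero ≡ - 1ℚ
  first-two = begin
    - 1ℚ * ℕ→ℚ (suc p) + gram p zero zero  ≡⟨ cong₂ (λ x y → - 1ℚ * x + y) (ℕ→ℚ-suc p) (gram-zero-zero p) ⟩
    - 1ℚ * (ℕ→ℚ p + 1ℚ) + ℕ→ℚ p            ≡⟨ solve 1 (λ x → :- con 1ℚ :* (x :+ con 1ℚ) :+ x := :- con 1ℚ) refl (ℕ→ℚ p) ⟩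
    - 1ℚ                                   ∎
    where open ≡-Reasoning
  gram-step-off : ∀ s j → s ≢ j → top p s * top p j + gram p (collapse s) (collapse j) ≡ - 1ℚ
  gram-step-off zero       zero       s≢j = ⊥-elim (s≢j refl)
  gram-step-off (suc zero) (suc zero) s≢j = ⊥-elim (s≢j refl)
  gram-step-off zero       (suc zero) _   = first-two
  gram-step-off (suc zero) zero       _   = trans (cong (_+ gram p zero zero) (*-comm (ℕ→ℚ (suc p)) (- 1ℚ))) first-two
  gram-step-off s (suc (suc j)) s≢j =
    trans (cong (_+ gram p (collapse s) (suc j)) (*-zeroʳ (top p s)))
          (trans (+-identityˡ _) (gram-off p (collapse s) (suc j) (collapse-≢ s j s≢j)))
  gram-step-off (suc (suc s)) j s≢j =
    trans (cong (_+ gram p (suc s) (collapse j)) (*-zeroˡ (top p j)))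
          (trans (+-identityˡ _) (gram-off p (suc s) (collapse j) (≢-sym (collapse-≢ j s (≢-sym s≢j)))))

-- Barycentric coordinates of m: 1/(p+1) for c_1, and 1/((r+1)(r+2)) for c_J, r = n − 1 − J.
β : (p : ℕ) → Fin (suc p) → ℚ
β p       zero          = recip p
β (suc p) (suc zero)    = recip p * recip (suc p)
β (suc p) (suc (suc j)) = β p (suc j)

β-positive : ∀ p j → Positive (β p j)
β-positive p       zero          = recip-positive p
β-positive (suc p) (suc zero)    = pos*pos⇒pos (recip p) {{recip-positive p}} (recip (suc p)) {{recip-positive (suc p)}}
β-positive (suc p) (suc (suc j)) = β-positive p (suc j)

β-merge : ∀ p → β (suc p) zero + β (suc p) (suc zero) ≡ β p zero
β-merge p = begin
  v + u * v                        ≡⟨ solve 2 (λ u v → v :+ u :* v := con 1ℚ :* v :+ u :* v) refl u v ⟩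
  1ℚ * v + u * v                   ≡⟨ cong (λ x → x * v + u * v) (recip-inverse p) ⟨
  u * N * v + u * v                ≡⟨ solve 3 (λ u v N → u :* N :* v :+ u :* v := u :* (v :* (N :+ con 1ℚ))) refl u v N ⟩
  u * (v * (N + 1ℚ))               ≡⟨ cong (λ x → u * (v * x)) (ℕ→ℚ-suc (suc p)) ⟨
  u * (v * ℕ→ℚ (suc (suc p)))      ≡⟨ cong (u *_) (recip-inverse (suc p)) ⟩
  u * 1ℚ                           ≡⟨ *-identityʳ u ⟩
  u                                ∎
  where
  open ≡-Reasoning
  u = recip p
  v = recip (suc p)
  N = ℕ→ℚ (suc p)

β-sum : ∀ p → Σℚ (β p) ≡ 1ℚ
β-sum zero    = refl
β-sum (suc p) = begin
  β (suc p) zero + (β (suc p) (suc zero) + rest)   ≡⟨ +-assoc (β (suc p) zero) _ rest ⟨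
  β (suc p) zero + β (suc p) (suc zero) + rest     ≡⟨ cong (_+ rest) (β-merge p) ⟩
  Σℚ (β p)                                         ≡⟨ β-sum p ⟩
  1ℚ                                               ∎
  where
  open ≡-Reasoning
  rest = Σℚ (λ j → β p (suc j))

Σβw-suc≡0 : ∀ p k → Σℚ (λ j → β p j * w p j (suc k)) ≡ 0ℚ
Σβw-suc≡0 zero    zero    = refl
Σβw-suc≡0 (suc p) zero    = begin
  v * - 1ℚ + (u * v * w (suc p) (suc zero) (suc zero) + rest)
      ≡⟨ cong₂ (λ x y → v * - 1ℚ + (u * v * x + y)) (w-top p (suc zero)) (Σℚ-zero (λ j → *-zeroʳ (β p (suc j)))) ⟩
  v * - 1ℚ + (u * v * N + 0ℚ)
      ≡⟨ solve 3 (λ u v N → v :* :- con 1ℚ :+ (u :* v :* N :+ con 0ℚ) := v :* (u :* N :- con 1ℚ)) refl u v N ⟩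
  v * (u * N - 1ℚ)   ≡⟨ cong (λ x → v * (x - 1ℚ)) (recip-inverse p) ⟩
  v * (1ℚ - 1ℚ)      ≡⟨ *-zeroʳ v ⟩
  0ℚ                 ∎
  where
  open ≡-Reasoning
  u = recip p
  v = recip (suc p)
  N = ℕ→ℚ (suc p)
  rest = Σℚ (λ j → β p (suc j) * w (suc p) (suc (suc j)) (suc zero))
Σβw-suc≡0 (suc p) (suc k) = begin
  β (suc p) zero * x + (β (suc p) (suc zero) * x + rest)
      ≡⟨ solve 4 (λ a b x r → a :* x :+ (b :* x :+ r) := (a :+ b) :* x :+ r) refl (β (suc p) zero) (β (suc p) (suc zero)) x rest ⟩
  (β (suc p) zero + β (suc p) (suc zero)) * x + rest       ≡⟨ cong (λ y → y * x + rest) (β-merge p) ⟩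
  Σℚ (λ j → β p j * w p j (suc k))                         ≡⟨ Σβw-suc≡0 p k ⟩
  0ℚ                                                       ∎
  where
  open ≡-Reasoning
  x = w p zero (suc k)
  rest = Σℚ (λ j → β p (suc j) * w p (suc j) (suc k))

Σβw≡0 : ∀ p i → Σℚ (λ j → β p j * w p j i) ≡ 0ℚ
Σβw≡0 p zero    = Σℚ-zero (λ j → trans (cong (β p j *_) (w-zero p j)) (*-zeroʳ (β p j)))
Σβw≡0 p (suc k) = Σβw-suc≡0 p k

c-isInt : ∀ n j i → IsIntℚ (c n j i)
c-isInt n j i with toℕ j
... | zero   = IsIntℚ-if (toℕ i ≡ᵇ 0) (ℤ.+ 1 , refl) (ℤ.+ 0 , refl)
... | suc j′ = IsIntℚ-if (suc (toℕ i) <ᵇ suc (suc j′)) (ℤ.+ 1 , refl)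
                 (IsIntℚ-if (suc (toℕ i) ≡ᵇ suc (suc j′)) (ℕ→ℚ-isInt (n ℕ.∸ suc (suc j′) ℕ.+ 1)) (ℤ.+ 0 , refl))

w-isLattice : ∀ p j → IsLatticePt (w p j)
w-isLattice p j i = IsIntℚ-+ (c-isInt (suc (suc p)) j i) (IsIntℚ-neg (onesThenZero-isLattice (suc p) i))

w-inDualLattice : ∀ p s → InDualLattice (c (suc (suc p))) (w p s)
w-inDualLattice p s ℓ ℓ-lattice _ = dot-IsIntℚ (w-isLattice p s) ℓ-lattice

theorem3 : (n : ℕ) → 2 ≤ n → ∃[ m ] ReflexiveAfterTranslation (c n) m
theorem3 (suc (suc p)) (s≤s (s≤s z≤n)) =
    m , onesThenZero-isLattice (suc p)
  , (β p , β-pos , β-sum p , balanced⇒isComb (c n) m (β p) (β-sum p) (Σβw≡0 p))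
  , suc p , w p , w-inDualLattice p , polar⇔convDual
  where
  n = suc (suc p)
  m = onesThenZero (suc p)
  β-pos : ∀ j → 0ℚ < β p j
  β-pos j = positive⁻¹ (β p j) {{β-positive p j}}
  open PolarOfSimplex (c n) m (β p) (w p) β-pos (β-sum p) (Σβw≡0 p)
    (λ s j s≢j → trans (val-w p s j) (gram-off p s j s≢j))
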